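{- Let $G=(V,E)$ be an undirected, connected, simple graph with adjacency matrix $A$, degrees $d_u$, neighborhoods $N(u)$ and Laplacian $L=D-A$; for $S\subsetneq V$ let $L_S$ be the principal submatrix of $L$ indexed by $S$ (which is invertible). Let $\mathcal H$ be a rooted tree with vertex set $V$ such that for every edge $\{x,y\}\in E$ one of $x,y$ is an ancestor of the other in $\mathcal H$. For $u\in V$ let $\mathrm{Desc}(u)$ be the set of descendants of $u$ in $\mathcal H$ including $u$, and $\mathrm{Desc}^-(u)=\mathrm{Desc}(u)\setminus\{u\}$. Define $\boldsymbol a_u\in\mathbb R^{\mathrm{Desc}^-(u)}$ by $\boldsymbol a_u[x]=A_{ux}$, define $\mathbf m_u\in\mathbb R^{\mathrm{Desc}(u)}$ by $\mathbf m_u[u]=1$ and $\mathbf m_u|_{\mathrm{Desc}^-(u)}=L_{\mathrm{Desc}^-(u)}^{ -1}\boldsymbol a_u$, and $f_u=d_u-\boldsymbol a_u^{\top}L_{\mathrm{Desc}^-(u)}^{ -1}\boldsymbol a_u$ (with $\mathbf m_u=\mathbf e_u$, $f_u=d_u$ when $\mathrm{Desc}^-(u)=\emptyset$). Then for every $v\in V$, every $f_u$ with $u\in\mathrm{Desc}^-(v)$ is nonzero and, viewing each $\mathbf m_u$ as a vector in $\mathbb R^{\mathrm{Desc}(v)}$ extended by zeros, $$\mathbf m_v=\mathbf e_v+\sum_{u\in\mathrm{Desc}^-(v)}\left(\frac{\sum_{x\in N(v)\cap\mathrm{Desc}(u)}\mathbf m_u[x]}{f_u}\right)\mathbf m_u,\qquad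 f_v=d_v-\sum_{x\in N(v)\cap\mathrm{Desc}(v)}\mathbf m_v[x].$$
   Context: The tree $\mathcal H$ models the paper's recursive vertex-cut hierarchy: vertices of a cut set form a chain and the components remaining after removing it are placed below, so every edge of $G$ joins an ancestor–descendant pair. The pair $(\mathbf m_u,f_u)$ is the stored index entry for vertex $u$. -}

module Defs where

open import Data.Nat using (ℕ; zero; suc)
open import Data.Fin using (Fin; zero; suc)
open import Data.Fin.Properties using () renaming (_≟_ to _≟ᶠ_)
open import Data.Bool using (Bool; true; false; _∧_; _∨_; not; if_then_else_)
open import Data.Maybe using (Maybe; just; nothing)
open import Data.Product using (Σ; _×_)
open import Data.Sum using (_⊎_)
open import Data.Rational using (ℚ; 0ℚ; 1ℚ; _+_; _*_; _-_; 1/_; ≢-nonZero)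
open import Data.Rational.Properties using (_≟_)
open import Relation.Nullary using (yes; no; ¬_)
open import Relation.Nullary.Decidable using (⌊_⌋)
open import Relation.Binary.PropositionalEquality using (_≡_; _≢_)

Σℚ : ∀ {n} → (Fin n → ℚ) → ℚ
Σℚ {zero}  f = 0ℚ
Σℚ {suc n} f = f zero + Σℚ {n} (λ i → f (suc i))

[_] : Bool → ℚ
[ b ] = if b then 1ℚ else 0ℚ

_==_ : ∀ {n} → Fin n → Fin n → Bool
x == y = ⌊ x ≟ᶠ y ⌋

-- Total reciprocal (0 ↦ 0); only applied to values proved nonzero in the theorem.
inv : ℚ → ℚ
inv p with p ≟ 0ℚ
... | yes _ = 0ℚ
... | no p≢0 = 1/_ p {{≢-nonZero p≢0}}

Graph : ℕ → Set
Graph n = Fin n → Fin n → Bool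

IsSimple : ∀ {n} → Graph n → Set
IsSimple {n} adj = (∀ x y → adj x y ≡ adj y x) × (∀ x → adj x x ≡ false)

data Reach {n} (adj : Graph n) : Fin n → Fin n → Set where
  here : ∀ {x} → Reach adj x x
  step : ∀ {x y z} → adj x y ≡ true → Reach adj y z → Reach adj x z

Connected : ∀ {n} → Graph n → Set
Connected {n} adj = ∀ (x y : Fin n) → Reach adj x y

Aₘ : ∀ {n} → Graph n → Fin n → Fin n → ℚ
Aₘ adj x y = [ adj x y ]

deg : ∀ {n} → Graph n → Fin n → ℚ
deg adj u = Σℚ (λ x → Aₘ adj u x)

Lap : ∀ {n} → Graph n → Fin n → Fin n → ℚ
Lap adj x y = ([ x == y ] * deg adj x) - Aₘ adj x y

Parent : ℕ → Set
Parent n = Fin n → Maybe (Fin n)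

ancB : ∀ {n} → ℕ → Parent n → Fin n → Fin n → Bool
ancB zero    p u x = u == x
ancB (suc k) p u x with p x
... | nothing = u == x
... | just y  = (u == x) ∨ ancB k p u y

anc : ∀ {n} → Parent n → Fin n → Fin n → Bool
anc {n} p u x = ancB n p u x

-- The parent map defines a rooted tree on all of Fin n: there is a root
-- with no parent which is an ancestor of every vertex (this forces
-- acyclicity, and a unique root).
IsRootedTree : ∀ {n} → Parent n → Set
IsRootedTree {n} p = Σ (Fin n) (λ r → (p r ≡ nothing) × (∀ v → anc p r v ≡ true))

Compatible : ∀ {n} → Graph n → Parent n → Set
Compatible {n} adj p = ∀ (x y : Fin n) → adj x y ≡ true →
  (anc p x y ≡ true) ⊎ (anc p y x ≡ true)

inDesc : ∀ {n} → Parent n → Fin n → Fin n → Bool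
inDesc p u x = anc p u x

inDesc⁻ : ∀ {n} → Parent n → Fin n → Fin n → Bool
inDesc⁻ p u x = anc p u x ∧ not (x == u)

-- Inverses of principal submatrices L_{Desc⁻(u)}.
-- Linv u is a matrix whose restriction to Desc⁻(u) × Desc⁻(u) is the
-- (two-sided) inverse of the restriction of L to Desc⁻(u) × Desc⁻(u).

IsSubInverse : ∀ {n} → (S : Fin n → Bool) → (M B : Fin n → Fin n → ℚ) → Set
IsSubInverse {n} S M B =
  (∀ x y → S x ≡ true → S y ≡ true →
     Σℚ (λ z → [ S z ] * (M x z * B z y)) ≡ [ x == y ]) ×
  (∀ x y → S x ≡ true → S y ≡ true →
     Σℚ (λ z → [ S z ] * (B x z * M z y)) ≡ [ x == y ])

module Index {n : ℕ} (adj : Graph n) (p : Parent n)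
             (Linv : Fin n → Fin n → Fin n → ℚ) where

  m : Fin n → Fin n → ℚ
  m u x = if x == u then 1ℚ
          else (if inDesc⁻ p u x
                then Σℚ (λ y → [ inDesc⁻ p u y ] * (Linv u x y * Aₘ adj u y))
                else 0ℚ)

  f : Fin n → ℚ
  f u = deg adj u -
        Σℚ (λ x → [ inDesc⁻ p u x ] *
          Σℚ (λ y → [ inDesc⁻ p u y ] * (Aₘ adj u x * (Linv u x y * Aₘ adj u y))))

  e : Fin n → Fin n → ℚ
  e v x = [ x == v ]

{-# OPTIONS --safe #-}
module Submission where

-- m u is the unique "potential" of u: it is 1 at u, vanishes outside Desc(u) and is
-- L-harmonic on Desc⁻(u) (existence from L·L⁻¹ = I, uniqueness from L⁻¹·L = I on Desc⁻(u)).
-- Evaluating L m u at y gives f u when y = u, 0 when y lies below u or is incomparable with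
-- u (every edge joins comparable vertices), and −(A m u)(y) when y is a proper ancestor of u.
-- If f u = 0 for some u other than the root, then m u is harmonic at each of its maxima, so
-- it is constant on the connected graph; but it is 1 at u and 0 at the root.  For the
-- recurrence, argue from the leaves up: expanding (A m y)(v) by the recurrence for each
-- proper descendant y of v shows that the right-hand side is again a potential of v, hence
-- equal to m v.  Finally f v = (L m v)(v) = d v − (A m v)(v).

open import Defs
open import Algebra.Bundles using (CommutativeRing)
open import Data.Bool using (Bool; true; false; _∧_; _∨_; not)
open import Data.Bool.Properties using (∨-zeroʳ; ∧-zeroʳ; ∧-identityʳ; ¬-not)
open import Data.Fin using (Fin; zero; suc)
open import Data.Fin.Properties using (_≟_; suc-injective)
open import Data.List using (allFin)
open import Data.List.Membership.Propositional.Properties using (∈-allFin)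
open import Data.List.Relation.Unary.All using (lookup)
open import Data.Maybe using (Maybe; just; nothing; _>>=_)
open import Data.Nat as ℕ using (ℕ; zero; suc)
import Data.Nat.Induction as ℕ
import Data.Nat.Properties as ℕ
open import Data.Product using (_×_; _,_; proj₁; proj₂; ∃-syntax)
open import Data.Rational using (ℚ; 0ℚ; 1ℚ; _+_; _*_; _-_; -_; _≤_; ≢-nonZero)
import Data.Rational.Properties as ℚ
open import Data.Rational.Properties using () renaming (_≟_ to _≟ℚ_)
open import Data.Rational.Solver using (module +-*-Solver)
open import Data.Sum using (_⊎_; inj₁; inj₂)
open import Data.Vec.Functional using (Vector)
open import Function using (_∘_)
open import Induction.WellFounded using (WellFounded; module Subrelation; module All)
open import Level using (0ℓ)
open import Relation.Binary.Bundles using (DecTotalOrder)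
import Relation.Binary.Construct.On as On
open import Relation.Binary.PropositionalEquality
  using (_≡_; _≢_; refl; sym; trans; cong; cong₂; subst; subst₂; module ≡-Reasoning)
open import Relation.Nullary using (yes; no; contradiction)
open import Relation.Nullary.Decidable using (⌊⌋-map′)

open import Algebra.Properties.Group ℚ.+-0-group using (x∙y⁻¹≈ε⇒x≈y; inverseʳ-unique; ⁻¹-involutive)
open import Algebra.Properties.Semiring.Sum (CommutativeRing.semiring ℚ.+-*-commutativeRing)
  using (sum; sum-cong-≗; sum-replicate-zero; ∑-distrib-+; ∑-comm; *-distribˡ-sum)
open import Data.List.Extrema (DecTotalOrder.totalOrder ℚ.≤-decTotalOrder)
  using (argmax; f[xs]≤f[argmax])

open ≡-Reasoning

private
  variable
    n : ℕ

==-refl : (x : Fin n) → (x == x) ≡ true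
==-refl x with x ≟ x
... | yes _   = refl
... | no x≢x = contradiction refl x≢x

==-false : {x y : Fin n} → x ≢ y → (x == y) ≡ false
==-false {x = x} {y} x≢y with x ≟ y
... | yes x≡y = contradiction x≡y x≢y
... | no _    = refl

==-sym : (x y : Fin n) → (x == y) ≡ (y == x)
==-sym x y with x ≟ y
... | yes refl = sym (==-refl x)
... | no x≢y   = sym (==-false (x≢y ∘ sym))

==⇒≡ : {x y : Fin n} → (x == y) ≡ true → x ≡ y
==⇒≡ {x = x} {y} x==y with x ≟ y
... | yes x≡y = x≡y

[]*-cong : (b : Bool) {p q : ℚ} → (b ≡ true → p ≡ q) → [ b ] * p ≡ [ b ] * q
[]*-cong true          p≡q = cong (1ℚ *_) (p≡q refl)
[]*-cong false {p} {q} _   = trans (ℚ.*-zeroˡ p) (sym (ℚ.*-zeroˡ q))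

[true]* : {b : Bool} → b ≡ true → (p : ℚ) → [ b ] * p ≡ p
[true]* refl = ℚ.*-identityˡ

[]*-support : (b : Bool) {q : ℚ} → (b ≡ false → q ≡ 0ℚ) → q ≡ [ b ] * q
[]*-support true  {q} _   = sym (ℚ.*-identityˡ q)
[]*-support false {q} q≡0 = trans (q≡0 refl) (sym (ℚ.*-zeroˡ q))

[∧]*-support : (a b : Bool) {q : ℚ} → (b ≡ false → q ≡ 0ℚ) → [ a ∧ b ] * q ≡ [ a ] * q
[∧]*-support a true  {q} _   = cong (λ c → [ c ] * q) (∧-identityʳ a)
[∧]*-support a false {q} q≡0 rewrite q≡0 refl = trans (ℚ.*-zeroʳ [ a ∧ false ]) (sym (ℚ.*-zeroʳ [ a ]))

[_]*-by-cases : (b : Bool) {q r : ℚ} → (b ≡ true → q ≡ r) → (b ≡ false → r ≡ 0ℚ) → [ b ] * q ≡ r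
[ true  ]*-by-cases {q} q≡r _   = trans (ℚ.*-identityˡ q) (q≡r refl)
[ false ]*-by-cases {q} _   r≡0 = trans (ℚ.*-zeroˡ q) (sym (r≡0 refl))

0≤[_]* : (b : Bool) {p : ℚ} → 0ℚ ≤ p → 0ℚ ≤ [ b ] * p
0≤[ true  ]* {p} 0≤p = subst (0ℚ ≤_) (sym (ℚ.*-identityˡ p)) 0≤p
0≤[ false ]* {p} _   = subst (0ℚ ≤_) (sym (ℚ.*-zeroˡ p)) ℚ.≤-refl

nonneg+nonneg≡0 : {p q : ℚ} → 0ℚ ≤ p → 0ℚ ≤ q → p + q ≡ 0ℚ → p ≡ 0ℚ
nonneg+nonneg≡0 {p} 0≤p 0≤q p+q≡0 =
  ℚ.≤-antisym (subst₂ _≤_ (ℚ.+-identityʳ p) p+q≡0 (ℚ.+-monoʳ-≤ p 0≤q)) 0≤p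

≤⇒0≤- : {p q : ℚ} → q ≤ p → 0ℚ ≤ p - q
≤⇒0≤- {p} {q} q≤p = subst (_≤ p - q) (ℚ.+-inverseʳ q) (ℚ.+-monoˡ-≤ (- q) q≤p)

inv-inverseˡ : (q : ℚ) → q ≢ 0ℚ → inv q * q ≡ 1ℚ
inv-inverseˡ q q≢0 with q ≟ℚ 0ℚ
... | yes q≡0 = contradiction q≡0 q≢0
... | no q≢0′ = ℚ.*-inverseˡ q {{≢-nonZero q≢0′}}

-- Finite sums

Σℚ≡sum : (f : Vector ℚ n) → Σℚ f ≡ sum f
Σℚ≡sum {zero}  f = refl
Σℚ≡sum {suc n} f = cong (f zero +_) (Σℚ≡sum (f ∘ suc))

Σℚ-cong : {f g : Vector ℚ n} → (∀ i → f i ≡ g i) → Σℚ f ≡ Σℚ g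
Σℚ-cong {f = f} {g} f≗g = begin
  Σℚ f  ≡⟨ Σℚ≡sum f ⟩
  sum f ≡⟨ sum-cong-≗ f≗g ⟩
  sum g ≡⟨ Σℚ≡sum g ⟨
  Σℚ g  ∎

Σℚ-zero : {f : Vector ℚ n} → (∀ i → f i ≡ 0ℚ) → Σℚ f ≡ 0ℚ
Σℚ-zero {n} f≗0 = trans (Σℚ-cong f≗0) (trans (Σℚ≡sum (λ (_ : Fin n) → 0ℚ)) (sum-replicate-zero n))

Σℚ-distrib-+ : (f g : Vector ℚ n) → Σℚ (λ i → f i + g i) ≡ Σℚ f + Σℚ g
Σℚ-distrib-+ f g = begin
  Σℚ (λ i → f i + g i) ≡⟨ Σℚ≡sum (λ i → f i + g i) ⟩
  sum (λ i → f i + g i) ≡⟨ ∑-distrib-+ f g ⟩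
  sum f + sum g        ≡⟨ cong₂ _+_ (Σℚ≡sum f) (Σℚ≡sum g) ⟨
  Σℚ f + Σℚ g          ∎

Σℚ-*ˡ : (c : ℚ) (f : Vector ℚ n) → Σℚ (λ i → c * f i) ≡ c * Σℚ f
Σℚ-*ˡ c f = begin
  Σℚ (λ i → c * f i)  ≡⟨ Σℚ≡sum (λ i → c * f i) ⟩
  sum (λ i → c * f i) ≡⟨ *-distribˡ-sum c f ⟨
  c * sum f           ≡⟨ cong (c *_) (Σℚ≡sum f) ⟨
  c * Σℚ f            ∎

Σℚ-comm : ∀ {m} (F : Fin m → Fin n → ℚ) →
          Σℚ (λ i → Σℚ (F i)) ≡ Σℚ (λ j → Σℚ (λ i → F i j))
Σℚ-comm {n} {m} F = begin
  Σℚ (λ i → Σℚ (F i))           ≡⟨ Σℚ-cong (Σℚ≡sum ∘ F) ⟩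
  Σℚ (λ i → sum (F i))          ≡⟨ Σℚ≡sum (λ i → sum (F i)) ⟩
  sum (λ i → sum (F i))         ≡⟨ ∑-comm F ⟩
  sum (λ j → sum (λ i → F i j)) ≡⟨ Σℚ≡sum (λ j → sum (λ i → F i j)) ⟨
  Σℚ (λ j → sum (λ i → F i j))  ≡⟨ Σℚ-cong (λ j → Σℚ≡sum (λ i → F i j)) ⟨
  Σℚ (λ j → Σℚ (λ i → F i j))   ∎

Σℚ-*ʳ : (c : ℚ) (f : Vector ℚ n) → Σℚ (λ i → f i * c) ≡ Σℚ f * c
Σℚ-*ʳ c f = begin
  Σℚ (λ i → f i * c) ≡⟨ Σℚ-cong (λ i → ℚ.*-comm (f i) c) ⟩
  Σℚ (λ i → c * f i) ≡⟨ Σℚ-*ˡ c f ⟩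
  c * Σℚ f           ≡⟨ ℚ.*-comm c (Σℚ f) ⟩
  Σℚ f * c           ∎

Σℚ-*ˡ² : (c d : ℚ) (f : Vector ℚ n) → Σℚ (λ i → c * (d * f i)) ≡ c * (d * Σℚ f)
Σℚ-*ˡ² c d f = trans (Σℚ-*ˡ c (λ i → d * f i)) (cong (c *_) (Σℚ-*ˡ d f))

Σℚ-neg : (f : Vector ℚ n) → Σℚ (λ i → - f i) ≡ - Σℚ f
Σℚ-neg {zero}  f = refl
Σℚ-neg {suc n} f =
  trans (cong (- f zero +_) (Σℚ-neg (f ∘ suc))) (sym (ℚ.neg-distrib-+ (f zero) (Σℚ (f ∘ suc))))

Σℚ-distrib-- : (f g : Vector ℚ n) → Σℚ (λ i → f i - g i) ≡ Σℚ f - Σℚ g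
Σℚ-distrib-- f g = trans (Σℚ-distrib-+ f (λ i → - g i)) (cong (Σℚ f +_) (Σℚ-neg g))

Σℚ-δ : (k : Fin n) (f : Vector ℚ n) → Σℚ (λ i → [ k == i ] * f i) ≡ f k
Σℚ-δ zero    f = begin
  1ℚ * f zero + Σℚ (λ i → 0ℚ * f (suc i))
    ≡⟨ cong₂ _+_ (ℚ.*-identityˡ (f zero)) (Σℚ-zero (λ i → ℚ.*-zeroˡ (f (suc i)))) ⟩
  f zero + 0ℚ
    ≡⟨ ℚ.+-identityʳ (f zero) ⟩
  f zero ∎
Σℚ-δ (suc k) f = begin
  0ℚ * f zero + Σℚ (λ i → [ suc k == suc i ] * f (suc i))
    ≡⟨ cong₂ _+_ (ℚ.*-zeroˡ (f zero)) (Σℚ-cong suc-==) ⟩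
  0ℚ + Σℚ (λ i → [ k == i ] * f (suc i))
    ≡⟨ trans (ℚ.+-identityˡ _) (Σℚ-δ k (f ∘ suc)) ⟩
  f (suc k) ∎
  where
  -- `suc k == suc i` does not reduce to `k == i`: `isYes` is stuck on the `map′`.
  suc-== : ∀ i → [ suc k == suc i ] * f (suc i) ≡ [ k == i ] * f (suc i)
  suc-== i = cong (λ b → [ b ] * f (suc i)) (⌊⌋-map′ (cong suc) suc-injective (k ≟ i))

Σℚ-δ′ : (k : Fin n) (f : Vector ℚ n) → Σℚ (λ i → [ i == k ] * f i) ≡ f k
Σℚ-δ′ k f = trans (Σℚ-cong (λ i → cong (λ b → [ b ] * f i) (==-sym i k))) (Σℚ-δ k f)

Σℚ-cong-on : (S : Fin n → Bool) {f g : Vector ℚ n} → (∀ i → S i ≡ true → f i ≡ g i) →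
             Σℚ (λ i → [ S i ] * f i) ≡ Σℚ (λ i → [ S i ] * g i)
Σℚ-cong-on S f≗g = Σℚ-cong (λ i → []*-cong (S i) (f≗g i))

Σℚ-zero-on : (S : Fin n → Bool) {f : Vector ℚ n} → (∀ i → S i ≡ true → f i ≡ 0ℚ) →
             Σℚ (λ i → [ S i ] * f i) ≡ 0ℚ
Σℚ-zero-on S f≗0 = Σℚ-zero (λ i → trans ([]*-cong (S i) (f≗0 i)) (ℚ.*-zeroʳ [ S i ]))

Σℚ-nonneg : {f : Vector ℚ n} → (∀ i → 0ℚ ≤ f i) → 0ℚ ≤ Σℚ f
Σℚ-nonneg {zero}      _   = ℚ.≤-refl
Σℚ-nonneg {suc n} {f} 0≤f =
  subst (_≤ Σℚ f) (ℚ.+-identityʳ 0ℚ) (ℚ.+-mono-≤ (0≤f zero) (Σℚ-nonneg (0≤f ∘ suc)))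

Σℚ-nonneg-≡0 : {f : Vector ℚ n} → (∀ i → 0ℚ ≤ f i) → Σℚ f ≡ 0ℚ → ∀ i → f i ≡ 0ℚ
Σℚ-nonneg-≡0 {suc n} {f} 0≤f Σ≡0 zero    = nonneg+nonneg≡0 (0≤f zero) (Σℚ-nonneg (0≤f ∘ suc)) Σ≡0
Σℚ-nonneg-≡0 {suc n} {f} 0≤f Σ≡0 (suc i) = Σℚ-nonneg-≡0 (0≤f ∘ suc) Σtail≡0 i
  where
  Σtail≡0 : Σℚ (f ∘ suc) ≡ 0ℚ
  Σtail≡0 = nonneg+nonneg≡0 (Σℚ-nonneg (0≤f ∘ suc)) (0≤f zero) (trans (ℚ.+-comm _ (f zero)) Σ≡0)

-- Matrices acting on vectors

Matrix : ℕ → Set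
Matrix n = Fin n → Fin n → ℚ

infix 8 _⊛_ _⊛[_]_

_⊛_ : Matrix n → Vector ℚ n → Vector ℚ n
(M ⊛ φ) y = Σℚ (λ z → M y z * φ z)

_⊛[_]_ : Matrix n → (Fin n → Bool) → Vector ℚ n → Vector ℚ n
(M ⊛[ S ] φ) y = Σℚ (λ z → [ S z ] * (M y z * φ z))

RightInverseOn : (Fin n → Bool) → Matrix n → Matrix n → Set
RightInverseOn S P Q = ∀ x y → S x ≡ true → S y ≡ true → (P ⊛[ S ] (λ z → Q z y)) x ≡ [ x == y ]

⊛-cancel : (S : Fin n → Bool) (P Q : Matrix n) → RightInverseOn S P Q →
           (a : Vector ℚ n) {x : Fin n} → S x ≡ true → (P ⊛[ S ] (Q ⊛[ S ] a)) x ≡ a x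
⊛-cancel S P Q PQ≡I a {x} Sx = begin
  Σℚ (λ z → [ S z ] * (P x z * Σℚ (λ t → [ S t ] * (Q z t * a t))))
    ≡⟨ Σℚ-cong (λ z → Σℚ-*ˡ² [ S z ] (P x z) (λ t → [ S t ] * (Q z t * a t))) ⟨
  Σℚ (λ z → Σℚ (λ t → [ S z ] * (P x z * ([ S t ] * (Q z t * a t)))))
    ≡⟨ Σℚ-comm (λ z t → [ S z ] * (P x z * ([ S t ] * (Q z t * a t)))) ⟩
  Σℚ (λ t → Σℚ (λ z → [ S z ] * (P x z * ([ S t ] * (Q z t * a t)))))
    ≡⟨ Σℚ-cong collect ⟩
  Σℚ (λ t → [ S t ] * ((P ⊛[ S ] (λ z → Q z t)) x * a t))
    ≡⟨ Σℚ-cong-on S (λ t St → cong (_* a t) (PQ≡I x t Sx St)) ⟩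
  Σℚ (λ t → [ S t ] * ([ x == t ] * a t))
    ≡⟨ Σℚ-cong (λ t → swap ([ S t ]) ([ x == t ]) (a t)) ⟩
  Σℚ (λ t → [ x == t ] * ([ S t ] * a t))
    ≡⟨ Σℚ-δ x (λ t → [ S t ] * a t) ⟩
  [ S x ] * a x
    ≡⟨ [true]* Sx (a x) ⟩
  a x ∎
  where
  open +-*-Solver
  swap : ∀ s e q → s * (e * q) ≡ e * (s * q)
  swap = solve 3 (λ s e q → s :* (e :* q) := e :* (s :* q)) refl
  regroup : ∀ s p u q b → s * (p * (u * (q * b))) ≡ u * ((s * (p * q)) * b)
  regroup = solve 5 (λ s p u q b → s :* (p :* (u :* (q :* b))) := u :* ((s :* (p :* q)) :* b)) refl
  collect : ∀ t → Σℚ (λ z → [ S z ] * (P x z * ([ S t ] * (Q z t * a t))))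
                ≡ [ S t ] * ((P ⊛[ S ] (λ z → Q z t)) x * a t)
  collect t = begin
    Σℚ (λ z → [ S z ] * (P x z * ([ S t ] * (Q z t * a t))))
      ≡⟨ Σℚ-cong (λ z → regroup [ S z ] (P x z) [ S t ] (Q z t) (a t)) ⟩
    Σℚ (λ z → [ S t ] * (([ S z ] * (P x z * Q z t)) * a t))
      ≡⟨ Σℚ-*ˡ [ S t ] (λ z → ([ S z ] * (P x z * Q z t)) * a t) ⟩
    [ S t ] * Σℚ (λ z → ([ S z ] * (P x z * Q z t)) * a t)
      ≡⟨ cong ([ S t ] *_) (Σℚ-*ʳ (a t) (λ z → [ S z ] * (P x z * Q z t))) ⟩
    [ S t ] * ((P ⊛[ S ] (λ z → Q z t)) x * a t) ∎

⊛-unit+combination : (M : Matrix n) (v : Fin n) (a b : Vector ℚ n) (ψ : Fin n → Vector ℚ n) (y : Fin n) →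
  (M ⊛ (λ x → [ x == v ] + Σℚ (λ u → a u * (b u * ψ u x)))) y ≡
  M y v + Σℚ (λ u → a u * (b u * (M ⊛ ψ u) y))
⊛-unit+combination M v a b ψ y = begin
  Σℚ (λ z → M y z * ([ z == v ] + Σℚ (λ u → a u * (b u * ψ u z))))
    ≡⟨ Σℚ-cong (λ z → ℚ.*-distribˡ-+ (M y z) [ z == v ] _) ⟩
  Σℚ (λ z → M y z * [ z == v ] + M y z * Σℚ (λ u → a u * (b u * ψ u z)))
    ≡⟨ Σℚ-distrib-+ (λ z → M y z * [ z == v ]) (λ z → M y z * Σℚ (λ u → a u * (b u * ψ u z))) ⟩
  Σℚ (λ z → M y z * [ z == v ]) + Σℚ (λ z → M y z * Σℚ (λ u → a u * (b u * ψ u z)))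
    ≡⟨ cong₂ _+_ unit combination ⟩
  M y v + Σℚ (λ u → a u * (b u * (M ⊛ ψ u) y)) ∎
  where
  open +-*-Solver
  unit : Σℚ (λ z → M y z * [ z == v ]) ≡ M y v
  unit = trans (Σℚ-cong (λ z → ℚ.*-comm (M y z) [ z == v ])) (Σℚ-δ′ v (M y))
  rearrange : ∀ m a b q → m * (a * (b * q)) ≡ a * (b * (m * q))
  rearrange = solve 4 (λ m a b q → m :* (a :* (b :* q)) := a :* (b :* (m :* q))) refl
  combination : Σℚ (λ z → M y z * Σℚ (λ u → a u * (b u * ψ u z))) ≡
                Σℚ (λ u → a u * (b u * (M ⊛ ψ u) y))
  combination = begin
    Σℚ (λ z → M y z * Σℚ (λ u → a u * (b u * ψ u z)))
      ≡⟨ Σℚ-cong (λ z → Σℚ-*ˡ (M y z) (λ u → a u * (b u * ψ u z))) ⟨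
    Σℚ (λ z → Σℚ (λ u → M y z * (a u * (b u * ψ u z))))
      ≡⟨ Σℚ-comm (λ z u → M y z * (a u * (b u * ψ u z))) ⟩
    Σℚ (λ u → Σℚ (λ z → M y z * (a u * (b u * ψ u z))))
      ≡⟨ Σℚ-cong (λ u → Σℚ-cong (λ z → rearrange (M y z) (a u) (b u) (ψ u z))) ⟩
    Σℚ (λ u → Σℚ (λ z → a u * (b u * (M y z * ψ u z))))
      ≡⟨ Σℚ-cong (λ u → Σℚ-*ˡ² (a u) (b u) (λ z → M y z * ψ u z)) ⟩
    Σℚ (λ u → a u * (b u * (M ⊛ ψ u) y)) ∎

-- The discrete maximum principle

IsMaximum : Vector ℚ n → Fin n → Set
IsMaximum φ j = ∀ z → φ z ≤ φ j

exists-maximum : (φ : Vector ℚ n) → Fin n → ∃[ j ] IsMaximum φ j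
exists-maximum {n} φ x =
  argmax φ x (allFin n) , λ z → lookup (f[xs]≤f[argmax] x (allFin n)) (∈-allFin z)

module _ {n : ℕ} (adj : Graph n) where

  Lap-⊛ : (φ : Vector ℚ n) (y : Fin n) → (Lap adj ⊛ φ) y ≡ deg adj y * φ y - (Aₘ adj ⊛ φ) y
  Lap-⊛ φ y = begin
    Σℚ (λ z → ([ y == z ] * deg adj y - Aₘ adj y z) * φ z)
      ≡⟨ Σℚ-cong (λ z → expand [ y == z ] (deg adj y) (Aₘ adj y z) (φ z)) ⟩
    Σℚ (λ z → [ y == z ] * (deg adj y * φ z) - Aₘ adj y z * φ z)
      ≡⟨ Σℚ-distrib-- (λ z → [ y == z ] * (deg adj y * φ z)) (λ z → Aₘ adj y z * φ z) ⟩
    Σℚ (λ z → [ y == z ] * (deg adj y * φ z)) - (Aₘ adj ⊛ φ) y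
      ≡⟨ cong (_- (Aₘ adj ⊛ φ) y) (Σℚ-δ y (λ z → deg adj y * φ z)) ⟩
    deg adj y * φ y - (Aₘ adj ⊛ φ) y ∎
    where
    open +-*-Solver
    expand : ∀ b d a q → (b * d - a) * q ≡ b * (d * q) - a * q
    expand = solve 4 (λ b d a q → (b :* d :- a) :* q := b :* (d :* q) :- a :* q) refl

  Lap-⊛-differences : (φ : Vector ℚ n) (y : Fin n) →
                      (Lap adj ⊛ φ) y ≡ Σℚ (λ z → Aₘ adj y z * (φ y - φ z))
  Lap-⊛-differences φ y = begin
    (Lap adj ⊛ φ) y
      ≡⟨ Lap-⊛ φ y ⟩
    deg adj y * φ y - (Aₘ adj ⊛ φ) y
      ≡⟨ cong (_- (Aₘ adj ⊛ φ) y) (Σℚ-*ʳ (φ y) (Aₘ adj y)) ⟨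
    Σℚ (λ z → Aₘ adj y z * φ y) - (Aₘ adj ⊛ φ) y
      ≡⟨ Σℚ-distrib-- (λ z → Aₘ adj y z * φ y) (λ z → Aₘ adj y z * φ z) ⟨
    Σℚ (λ z → Aₘ adj y z * φ y - Aₘ adj y z * φ z)
      ≡⟨ Σℚ-cong (λ z → factor (Aₘ adj y z) (φ y) (φ z)) ⟩
    Σℚ (λ z → Aₘ adj y z * (φ y - φ z)) ∎
    where
    open +-*-Solver
    factor : ∀ a p q → a * p - a * q ≡ a * (p - q)
    factor = solve 3 (λ a p q → a :* p :- a :* q := a :* (p :- q)) refl

  maximum-spreads : {φ : Vector ℚ n} {j z : Fin n} → IsMaximum φ j → (Lap adj ⊛ φ) j ≡ 0ℚ →
                    adj j z ≡ true → φ z ≡ φ j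
  maximum-spreads {φ} {j} {z} max-j harmonic-j jz = sym (x∙y⁻¹≈ε⇒x≈y (φ j) (φ z) gap≡0)
    where
    terms≡0 : ∀ w → Aₘ adj j w * (φ j - φ w) ≡ 0ℚ
    terms≡0 = Σℚ-nonneg-≡0 (λ w → 0≤[ adj j w ]* (≤⇒0≤- (max-j w)))
                            (trans (sym (Lap-⊛-differences φ j)) harmonic-j)
    gap≡0 : φ j - φ z ≡ 0ℚ
    gap≡0 = trans (sym ([true]* jz (φ j - φ z))) (terms≡0 z)

  maximum-principle : Connected adj → (φ : Vector ℚ n) →
                      (∀ j → IsMaximum φ j → (Lap adj ⊛ φ) j ≡ 0ℚ) → ∀ x y → φ x ≡ φ y
  maximum-principle connected φ harmonic-at-maxima x y =
    trans (constant-from (connected i x) max-i) (sym (constant-from (connected i y) max-i))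
    where
    i = proj₁ (exists-maximum φ x)
    max-i = proj₂ (exists-maximum φ x)
    constant-from : ∀ {j k} → Reach adj j k → IsMaximum φ j → φ k ≡ φ j
    constant-from here                       _     = refl
    constant-from (step {y = z} jz reach-zk) max-j =
      trans (constant-from reach-zk max-z) φz≡φj
      where
      φz≡φj = maximum-spreads max-j (harmonic-at-maxima _ max-j) jz
      max-z : IsMaximum φ z
      max-z w = subst (φ w ≤_) (sym φz≡φj) (max-j w)

-- Ancestors in the rooted tree

inDesc⁻-self : {p : Parent n} (u : Fin n) → inDesc⁻ p u u ≡ false
inDesc⁻-self {p = p} u = trans (cong (λ b → anc p u u ∧ not b) (==-refl u)) (∧-zeroʳ (anc p u u))

inDesc⁻-anc : {p : Parent n} {u x : Fin n} → inDesc⁻ p u x ≡ true → anc p u x ≡ true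
inDesc⁻-anc {p = p} {u} {x} u⊐x with anc p u x | u⊐x
... | true | _ = refl

inDesc⁻-≢ : {p : Parent n} {u x : Fin n} → inDesc⁻ p u x ≡ true → x ≢ u
inDesc⁻-≢ {u = u} u⊐u refl with () ← trans (sym u⊐u) (inDesc⁻-self u)

inDesc⁻-outside : {p : Parent n} {u x : Fin n} → anc p u x ≡ false → inDesc⁻ p u x ≡ false
inDesc⁻-outside {u = u} {x} anc-ux≡false = cong (λ a → a ∧ not (x == u)) anc-ux≡false

inDesc⁻-intro : {p : Parent n} {u x : Fin n} → anc p u x ≡ true → x ≢ u → inDesc⁻ p u x ≡ true
inDesc⁻-intro anc-ux x≢u = cong₂ (λ a b → a ∧ not b) anc-ux (==-false x≢u)

module Ancestry {n : ℕ} (p : Parent n) where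

  climb : ℕ → Fin n → Maybe (Fin n)
  climb zero    x = just x
  climb (suc k) x = p x >>= climb k

  climb-+ : ∀ j k x → climb (j ℕ.+ k) x ≡ (climb j x >>= climb k)
  climb-+ zero    k x = refl
  climb-+ (suc j) k x with p x
  ... | nothing = refl
  ... | just y  = climb-+ j k y

  climb-split : ∀ a c {b x u} → climb a x ≡ just u → a ℕ.+ c ≡ b → climb b x ≡ climb c u
  climb-split a c {b} {x} {u} climb-a a+c≡b = begin
    climb b x                ≡⟨ cong (λ k → climb k x) a+c≡b ⟨
    climb (a ℕ.+ c) x        ≡⟨ climb-+ a c x ⟩
    (climb a x >>= climb c)  ≡⟨ cong (_>>= climb c) climb-a ⟩
    climb c u                ∎

  ancB-refl : ∀ k x → ancB k p x x ≡ true
  ancB-refl zero    x = ==-refl x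
  ancB-refl (suc k) x with p x
  ... | nothing = ==-refl x
  ... | just y  = cong (_∨ ancB k p x y) (==-refl x)

  anc-refl : ∀ x → anc p x x ≡ true
  anc-refl = ancB-refl n

  non-anc⇒≢ : ∀ {u x} → anc p u x ≡ false → x ≢ u
  non-anc⇒≢ {u} anc-ux≡false refl with () ← trans (sym (anc-refl u)) anc-ux≡false

  -- Both `with`s also abstract inside `inDesc⁻ p u x`, which is why `refl` suffices below.
  position : ∀ u x → x ≡ u ⊎ inDesc⁻ p u x ≡ true ⊎ anc p u x ≡ false
  position u x with x ≟ u
  ... | yes x≡u = inj₁ x≡u
  ... | no x≢u with anc p u x
  ...   | true  = inj₂ (inj₁ refl)
  ...   | false = inj₂ (inj₂ refl)

  ancB-sound : ∀ k {u x} → ancB k p u x ≡ true → ∃[ j ] j ℕ.≤ k × climb j x ≡ just u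
  ancB-sound zero    u==x = 0 , ℕ.z≤n , cong just (sym (==⇒≡ u==x))
  ancB-sound (suc k) {u} {x} ancB-ux with p x in px
  ... | nothing = 0 , ℕ.z≤n , cong just (sym (==⇒≡ ancB-ux))
  ... | just y with u == x in u==x
  ...   | true  = 0 , ℕ.z≤n , cong just (sym (==⇒≡ u==x))
  ...   | false with ancB-sound k ancB-ux
  ...     | j , j≤k , climb-j = suc j , ℕ.s≤s j≤k , trans (cong (_>>= climb j) px) climb-j

  ancB-complete : ∀ {k j u x} → j ℕ.≤ k → climb j x ≡ just u → ancB k p u x ≡ true
  ancB-complete {k} {zero} {u} _ refl = ancB-refl k u
  ancB-complete {suc k} {suc j} {u} {x} (ℕ.s≤s j≤k) climb-ux with p x in px
  ... | just y  = trans (cong ((u == x) ∨_) (ancB-complete j≤k climb-ux)) (∨-zeroʳ (u == x))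

module RootedTree {n : ℕ} {p : Parent n} (tree : IsRootedTree p) where

  open Ancestry p

  root : Fin n
  root = proj₁ tree

  root-anc : ∀ x → anc p root x ≡ true
  root-anc = proj₂ (proj₂ tree)

  _≼_ : Fin n → Fin n → Set
  u ≼ x = ∃[ j ] climb j x ≡ just u

  ≼⇐anc : {u x : Fin n} → anc p u x ≡ true → u ≼ x
  ≼⇐anc anc-ux = let (j , _ , climb-j) = ancB-sound n anc-ux in j , climb-j

  depth : Fin n → ℕ
  depth x = proj₁ (ancB-sound n (root-anc x))

  depth≤n : ∀ x → depth x ℕ.≤ n
  depth≤n x = proj₁ (proj₂ (ancB-sound n (root-anc x)))

  climb-depth : ∀ x → climb (depth x) x ≡ just root
  climb-depth x = proj₂ (proj₂ (ancB-sound n (root-anc x)))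

  climb-past-root : ∀ k → climb (suc k) root ≡ nothing
  climb-past-root k rewrite proj₁ (proj₂ tree) = refl

  climb-to-root-≤ : ∀ {a b x} → climb a x ≡ just root → climb b x ≡ just root → a ℕ.≤ b → a ≡ b
  climb-to-root-≤ {a} climb-a climb-b a≤b with ℕ.m≤n⇒∃[o]m+o≡n a≤b
  ... | zero  , a+0≡b = trans (sym (ℕ.+-identityʳ a)) a+0≡b
  ... | suc c , a+c≡b with trans (sym climb-b) (trans (climb-split a (suc c) climb-a a+c≡b) (climb-past-root c))
  ...   | ()

  climb-to-root-unique : ∀ {a b x} → climb a x ≡ just root → climb b x ≡ just root → a ≡ b
  climb-to-root-unique {a} {b} climb-a climb-b with ℕ.≤-total a b
  ... | inj₁ a≤b = climb-to-root-≤ climb-a climb-b a≤b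
  ... | inj₂ b≤a = sym (climb-to-root-≤ climb-b climb-a b≤a)

  depth-climb : ∀ {j u x} → climb j x ≡ just u → depth x ≡ j ℕ.+ depth u
  depth-climb {j} {u} climb-j =
    climb-to-root-unique (climb-depth _) (trans (climb-split j (depth u) climb-j refl) (climb-depth u))

  ≼⇒anc : {u x : Fin n} → u ≼ x → anc p u x ≡ true
  ≼⇒anc {u} {x} (j , climb-j) = ancB-complete j≤n climb-j
    where
    j≤n : j ℕ.≤ n
    j≤n = ℕ.≤-trans (subst (j ℕ.≤_) (sym (depth-climb climb-j)) (ℕ.m≤m+n j (depth u))) (depth≤n x)

  depth-< : {u x : Fin n} → u ≼ x → x ≢ u → depth u ℕ.< depth x
  depth-< (zero  , refl) x≢x = contradiction refl x≢x
  depth-< {u} (suc j , climb-j) _ =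
    subst (depth u ℕ.<_) (sym (depth-climb climb-j)) (ℕ.s≤s (ℕ.m≤n+m (depth u) j))

  ≼-trans : {u y x : Fin n} → u ≼ y → y ≼ x → u ≼ x
  ≼-trans (b , climb-b) (a , climb-a) = a ℕ.+ b , trans (climb-split a b climb-a refl) climb-b

  ≼-antisym : {u x : Fin n} → u ≼ x → x ≼ u → u ≡ x
  ≼-antisym {u} {x} u≼x x≼u with u ≟ x
  ... | yes u≡x = u≡x
  ... | no u≢x  = contradiction (ℕ.<-trans (depth-< u≼x (u≢x ∘ sym)) (depth-< x≼u u≢x)) (ℕ.<-irrefl refl)

  ≼-linear : {u y z : Fin n} → u ≼ z → y ≼ z → u ≼ y ⊎ y ≼ u
  ≼-linear (a , climb-a) (b , climb-b) with ℕ.≤-total a b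
  ... | inj₁ a≤b = let (c , a+c≡b) = ℕ.m≤n⇒∃[o]m+o≡n a≤b in
                   inj₂ (c , trans (sym (climb-split a c climb-a a+c≡b)) climb-b)
  ... | inj₂ b≤a = let (c , b+c≡a) = ℕ.m≤n⇒∃[o]m+o≡n b≤a in
                   inj₁ (c , trans (sym (climb-split b c climb-b b+c≡a)) climb-a)

  anc-trans : {u y x : Fin n} → anc p u y ≡ true → anc p y x ≡ true → anc p u x ≡ true
  anc-trans u-y y-x = ≼⇒anc (≼-trans (≼⇐anc u-y) (≼⇐anc y-x))

  anc-antisym : {u x : Fin n} → anc p u x ≡ true → anc p x u ≡ true → u ≡ x
  anc-antisym u-x x-u = ≼-antisym (≼⇐anc u-x) (≼⇐anc x-u)

  anc-linear : {u y z : Fin n} → anc p u z ≡ true → anc p y z ≡ true →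
               anc p u y ≡ true ⊎ anc p y u ≡ true
  anc-linear u-z y-z with ≼-linear (≼⇐anc u-z) (≼⇐anc y-z)
  ... | inj₁ u≼y = inj₁ (≼⇒anc u≼y)
  ... | inj₂ y≼u = inj₂ (≼⇒anc y≼u)

  ⊐⇒non-anc : {v u : Fin n} → inDesc⁻ p v u ≡ true → anc p u v ≡ false
  ⊐⇒non-anc {v} {u} v⊐u =
    ¬-not (λ anc-uv → inDesc⁻-≢ {p = p} v⊐u (anc-antisym anc-uv (inDesc⁻-anc {p = p} v⊐u)))

  ⊐-trans : {v y u : Fin n} → inDesc⁻ p v y ≡ true → inDesc⁻ p y u ≡ true → inDesc⁻ p v u ≡ true
  ⊐-trans {v} {y} {u} v⊐y y⊐u = inDesc⁻-intro {p = p} anc-vu u≢v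
    where
    anc-vu = anc-trans (inDesc⁻-anc {p = p} v⊐y) (inDesc⁻-anc {p = p} y⊐u)
    u≢v : u ≢ v
    u≢v refl with () ← trans (sym (inDesc⁻-anc {p = p} y⊐u)) (⊐⇒non-anc v⊐y)

  _⊏_ : Fin n → Fin n → Set
  y ⊏ v = inDesc⁻ p v y ≡ true

  ⊏-wellFounded : WellFounded _⊏_
  ⊏-wellFounded = Subrelation.wellFounded shrinks (On.wellFounded height ℕ.<-wellFounded)
    where
    height : Fin n → ℕ
    height v = n ℕ.∸ depth v
    shrinks : ∀ {y v} → y ⊏ v → height y ℕ.< height v
    shrinks {y} y⊏v =
      ℕ.∸-monoʳ-< (depth-< (≼⇐anc (inDesc⁻-anc {p = p} y⊏v)) (inDesc⁻-≢ {p = p} y⊏v)) (depth≤n y)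

[anc]-split : (p : Parent n) (u z : Fin n) → [ anc p u z ] ≡ [ z == u ] + [ inDesc⁻ p u z ]
[anc]-split p u z with z ≟ u
... | yes refl = begin
  [ anc p z z ]                  ≡⟨ cong [_] (Ancestry.anc-refl p z) ⟩
  1ℚ                             ≡⟨ ℚ.+-identityʳ 1ℚ ⟨
  1ℚ + 0ℚ                        ≡⟨ cong (λ b → 1ℚ + [ b ]) (∧-zeroʳ (anc p z z)) ⟨
  1ℚ + [ anc p z z ∧ false ]     ∎
... | no _ = begin
  [ anc p u z ]                  ≡⟨ ℚ.+-identityˡ _ ⟨
  0ℚ + [ anc p u z ]             ≡⟨ cong (λ b → 0ℚ + [ b ]) (∧-identityʳ (anc p u z)) ⟨
  0ℚ + [ anc p u z ∧ true ]      ∎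

⊛-split-at : (p : Parent n) (M : Matrix n) {u : Fin n} {φ : Vector ℚ n} →
             (∀ z → anc p u z ≡ false → φ z ≡ 0ℚ) →
             ∀ y → (M ⊛ φ) y ≡ M y u * φ u + (M ⊛[ inDesc⁻ p u ] φ) y
⊛-split-at p M {u} {φ} outside y = begin
  Σℚ (λ z → M y z * φ z)
    ≡⟨ Σℚ-cong split ⟩
  Σℚ (λ z → [ z == u ] * (M y z * φ z) + [ inDesc⁻ p u z ] * (M y z * φ z))
    ≡⟨ Σℚ-distrib-+ (λ z → [ z == u ] * (M y z * φ z)) (λ z → [ inDesc⁻ p u z ] * (M y z * φ z)) ⟩
  Σℚ (λ z → [ z == u ] * (M y z * φ z)) + (M ⊛[ inDesc⁻ p u ] φ) y
    ≡⟨ cong (_+ (M ⊛[ inDesc⁻ p u ] φ) y) (Σℚ-δ′ u (λ z → M y z * φ z)) ⟩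
  M y u * φ u + (M ⊛[ inDesc⁻ p u ] φ) y ∎
  where
  open +-*-Solver
  distribute : ∀ m a b q → m * ((a + b) * q) ≡ a * (m * q) + b * (m * q)
  distribute = solve 4 (λ m a b q → m :* ((a :+ b) :* q) := a :* (m :* q) :+ b :* (m :* q)) refl
  split : ∀ z → M y z * φ z ≡ [ z == u ] * (M y z * φ z) + [ inDesc⁻ p u z ] * (M y z * φ z)
  split z = begin
    M y z * φ z                                     ≡⟨ cong (M y z *_) ([]*-support (anc p u z) (outside z)) ⟩
    M y z * ([ anc p u z ] * φ z)                   ≡⟨ cong (λ a → M y z * (a * φ z)) ([anc]-split p u z) ⟩
    M y z * (([ z == u ] + [ inDesc⁻ p u z ]) * φ z) ≡⟨ distribute (M y z) [ z == u ] [ inDesc⁻ p u z ] (φ z) ⟩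
    [ z == u ] * (M y z * φ z) + [ inDesc⁻ p u z ] * (M y z * φ z) ∎

-- The index vectors as potentials

module IndexVectors {n : ℕ} (adj : Graph n) (p : Parent n) (Linv : Fin n → Matrix n) where

  open Index adj p Linv
  open Ancestry p using (non-anc⇒≢)

  m⁻ : Fin n → Vector ℚ n
  m⁻ u = Linv u ⊛[ inDesc⁻ p u ] Aₘ adj u

  m-self : ∀ u → m u u ≡ 1ℚ
  m-self u rewrite ==-refl u = refl

  m-below : ∀ {u x} → inDesc⁻ p u x ≡ true → m u x ≡ m⁻ u x
  m-below {u} {x} u⊐x rewrite ==-false (inDesc⁻-≢ {p = p} u⊐x) | inDesc⁻-anc {p = p} u⊐x = refl

  m-outside : ∀ {u x} → anc p u x ≡ false → m u x ≡ 0ℚ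
  m-outside {u} {x} anc-ux≡false rewrite ==-false (non-anc⇒≢ anc-ux≡false) | anc-ux≡false = refl

  coeff : Fin n → Fin n → ℚ
  coeff v u = Σℚ (λ y → [ adj v y ∧ inDesc p u y ] * m u y)

  coeff≡A⊛m : ∀ v u → coeff v u ≡ (Aₘ adj ⊛ m u) v
  coeff≡A⊛m v u = Σℚ-cong (λ y → [∧]*-support (adj v y) (anc p u y) m-outside)

  coeff-swap : ∀ v y u → (coeff v u * inv (f u)) * (Aₘ adj ⊛ m u) y ≡
                         (coeff y u * inv (f u)) * (Aₘ adj ⊛ m u) v
  coeff-swap v y u = begin
    (coeff v u * i) * b  ≡⟨ cong (λ c → (c * i) * b) (coeff≡A⊛m v u) ⟩
    (a * i) * b          ≡⟨ solve 3 (λ a i b → (a :* i) :* b := (b :* i) :* a) refl a i b ⟩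
    (b * i) * a          ≡⟨ cong (λ c → (c * i) * a) (coeff≡A⊛m y u) ⟨
    (coeff y u * i) * a  ∎
    where
    open +-*-Solver
    i = inv (f u)
    a = (Aₘ adj ⊛ m u) v
    b = (Aₘ adj ⊛ m u) y

  expansion : Fin n → Vector ℚ n
  expansion v x = e v x + Σℚ (λ u → [ inDesc⁻ p v u ] * ((coeff v u * inv (f u)) * m u x))

  -- The voltage on Desc(u) when u is held at 1 and every vertex outside Desc(u) is grounded.
  record IsPotential (u : Fin n) (φ : Vector ℚ n) : Set where
    field
      at-self  : φ u ≡ 1ℚ
      outside  : ∀ x → anc p u x ≡ false → φ x ≡ 0ℚ
      harmonic : ∀ y → inDesc⁻ p u y ≡ true → (Lap adj ⊛ φ) y ≡ 0ℚ

module Potentials {n : ℕ} (adj : Graph n) (p : Parent n) (Linv : Fin n → Matrix n)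
                  (simple : IsSimple adj) (tree : IsRootedTree p)
                  (inverses : ∀ u → IsSubInverse (inDesc⁻ p u) (Lap adj) (Linv u)) where

  open Index adj p Linv
  open IndexVectors adj p Linv
  open Ancestry p using (position)
  open RootedTree tree

  A-sym : ∀ x y → Aₘ adj x y ≡ Aₘ adj y x
  A-sym x y = cong [_] (proj₁ simple x y)

  A-loop : ∀ x → Aₘ adj x x ≡ 0ℚ
  A-loop x = cong [_] (proj₂ simple x)

  Lap-offdiag : ∀ {y z} → y ≢ z → Lap adj y z ≡ - Aₘ adj y z
  Lap-offdiag {y} {z} y≢z rewrite ==-false y≢z =
    trans (cong (_- Aₘ adj y z) (ℚ.*-zeroˡ (deg adj y))) (ℚ.+-identityˡ (- Aₘ adj y z))

  m-potential : ∀ u → IsPotential u (m u)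
  m-potential u = record { at-self = m-self u ; outside = λ _ → m-outside ; harmonic = harmonic }
    where
    S = inDesc⁻ p u
    harmonic : ∀ y → S y ≡ true → (Lap adj ⊛ m u) y ≡ 0ℚ
    harmonic y u⊐y = begin
      (Lap adj ⊛ m u) y
        ≡⟨ ⊛-split-at p (Lap adj) (λ _ → m-outside) y ⟩
      Lap adj y u * m u u + (Lap adj ⊛[ S ] m u) y
        ≡⟨ cong₂ _+_ (cong (Lap adj y u *_) (m-self u))
                     (Σℚ-cong-on S (λ z u⊐z → cong (Lap adj y z *_) (m-below u⊐z))) ⟩
      Lap adj y u * 1ℚ + (Lap adj ⊛[ S ] m⁻ u) y
        ≡⟨ cong₂ _+_ (trans (ℚ.*-identityʳ _) (Lap-offdiag (inDesc⁻-≢ {p = p} u⊐y)))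
                     (⊛-cancel S (Lap adj) (Linv u) (proj₁ (inverses u)) (Aₘ adj u) u⊐y) ⟩
      - Aₘ adj y u + Aₘ adj u y
        ≡⟨ cong (λ a → - a + Aₘ adj u y) (A-sym y u) ⟩
      - Aₘ adj u y + Aₘ adj u y
        ≡⟨ ℚ.+-inverseˡ (Aₘ adj u y) ⟩
      0ℚ ∎

  potential-unique : ∀ {u φ} → IsPotential u φ → ∀ x → φ x ≡ m u x
  potential-unique {u} {φ} pot x = agree (position u x)
    where
    open IsPotential pot
    S = inDesc⁻ p u
    L⊛[S]φ : ∀ y → S y ≡ true → (Lap adj ⊛[ S ] φ) y ≡ Aₘ adj u y
    L⊛[S]φ y u⊐y = begin
      (Lap adj ⊛[ S ] φ) y
        ≡⟨ inverseʳ-unique _ _ (trans (sym (⊛-split-at p (Lap adj) outside y)) (harmonic y u⊐y)) ⟩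
      - (Lap adj y u * φ u)
        ≡⟨ cong (λ a → - (Lap adj y u * a)) at-self ⟩
      - (Lap adj y u * 1ℚ)
        ≡⟨ cong -_ (trans (ℚ.*-identityʳ _) (Lap-offdiag (inDesc⁻-≢ {p = p} u⊐y))) ⟩
      - - Aₘ adj y u
        ≡⟨ ⁻¹-involutive (Aₘ adj y u) ⟩
      Aₘ adj y u
        ≡⟨ A-sym y u ⟩
      Aₘ adj u y ∎
    below : S x ≡ true → φ x ≡ m⁻ u x
    below u⊐x = begin
      φ x
        ≡⟨ ⊛-cancel S (Linv u) (Lap adj) (proj₂ (inverses u)) φ u⊐x ⟨
      (Linv u ⊛[ S ] (Lap adj ⊛[ S ] φ)) x
        ≡⟨ Σℚ-cong-on S (λ y u⊐y → cong (Linv u x y *_) (L⊛[S]φ y u⊐y)) ⟩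
      m⁻ u x ∎
    agree : x ≡ u ⊎ S x ≡ true ⊎ anc p u x ≡ false → φ x ≡ m u x
    agree (inj₁ x≡u)        = subst (λ z → φ z ≡ m u z) (sym x≡u) (trans at-self (sym (m-self u)))
    agree (inj₂ (inj₁ u⊐x)) = trans (below u⊐x) (sym (m-below u⊐x))
    agree (inj₂ (inj₂ u∤x)) = trans (outside x u∤x) (sym (m-outside u∤x))

  A⊛m-self : ∀ u → (Aₘ adj ⊛ m u) u ≡ (Aₘ adj ⊛[ inDesc⁻ p u ] m⁻ u) u
  A⊛m-self u = begin
    (Aₘ adj ⊛ m u) u
      ≡⟨ ⊛-split-at p (Aₘ adj) (λ _ → m-outside) u ⟩
    Aₘ adj u u * m u u + (Aₘ adj ⊛[ S ] m u) u
      ≡⟨ cong₂ _+_ (trans (cong (_* m u u) (A-loop u)) (ℚ.*-zeroˡ (m u u)))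
                   (Σℚ-cong-on S (λ z u⊐z → cong (Aₘ adj u z *_) (m-below u⊐z))) ⟩
    0ℚ + (Aₘ adj ⊛[ S ] m⁻ u) u
      ≡⟨ ℚ.+-identityˡ _ ⟩
    (Aₘ adj ⊛[ S ] m⁻ u) u ∎
    where
    S = inDesc⁻ p u

  f≡deg-A⊛m : ∀ u → f u ≡ deg adj u - (Aₘ adj ⊛ m u) u
  f≡deg-A⊛m u = cong (λ q → deg adj u - q) (begin
    Σℚ (λ x → [ S x ] * Σℚ (λ y → [ S y ] * (Aₘ adj u x * (Linv u x y * Aₘ adj u y))))
      ≡⟨ Σℚ-cong (λ x → cong ([ S x ] *_) (factor x)) ⟩
    (Aₘ adj ⊛[ S ] m⁻ u) u
      ≡⟨ A⊛m-self u ⟨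
    (Aₘ adj ⊛ m u) u ∎)
    where
    S = inDesc⁻ p u
    open +-*-Solver
    swap : ∀ s a q → s * (a * q) ≡ a * (s * q)
    swap = solve 3 (λ s a q → s :* (a :* q) := a :* (s :* q)) refl
    factor : ∀ x → Σℚ (λ y → [ S y ] * (Aₘ adj u x * (Linv u x y * Aₘ adj u y))) ≡ Aₘ adj u x * m⁻ u x
    factor x = trans (Σℚ-cong (λ y → swap [ S y ] (Aₘ adj u x) (Linv u x y * Aₘ adj u y)))
                     (Σℚ-*ˡ (Aₘ adj u x) (λ y → [ S y ] * (Linv u x y * Aₘ adj u y)))

  Lap⊛m-self : ∀ u → (Lap adj ⊛ m u) u ≡ f u
  Lap⊛m-self u = begin
    (Lap adj ⊛ m u) u                          ≡⟨ Lap-⊛ adj (m u) u ⟩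
    deg adj u * m u u - (Aₘ adj ⊛ m u) u       ≡⟨ cong (λ q → deg adj u * q - (Aₘ adj ⊛ m u) u) (m-self u) ⟩
    deg adj u * 1ℚ - (Aₘ adj ⊛ m u) u          ≡⟨ cong (_- (Aₘ adj ⊛ m u) u) (ℚ.*-identityʳ (deg adj u)) ⟩
    deg adj u - (Aₘ adj ⊛ m u) u               ≡⟨ f≡deg-A⊛m u ⟨
    f u                                        ∎

  Lap⊛m-outside : ∀ {u y} → anc p u y ≡ false → (Lap adj ⊛ m u) y ≡ - (Aₘ adj ⊛ m u) y
  Lap⊛m-outside {u} {y} u∤y = begin
    (Lap adj ⊛ m u) y                          ≡⟨ Lap-⊛ adj (m u) y ⟩
    deg adj y * m u y - (Aₘ adj ⊛ m u) y       ≡⟨ cong (λ q → deg adj y * q - (Aₘ adj ⊛ m u) y) (m-outside u∤y) ⟩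
    deg adj y * 0ℚ - (Aₘ adj ⊛ m u) y          ≡⟨ cong (_- (Aₘ adj ⊛ m u) y) (ℚ.*-zeroʳ (deg adj y)) ⟩
    0ℚ - (Aₘ adj ⊛ m u) y                      ≡⟨ ℚ.+-identityˡ _ ⟩
    - (Aₘ adj ⊛ m u) y                         ∎

  A⊛m-incomparable : Compatible adj p → ∀ {u y} → anc p u y ≡ false → anc p y u ≡ false →
                     (Aₘ adj ⊛ m u) y ≡ 0ℚ
  A⊛m-incomparable compatible {u} {y} u∤y y∤u = Σℚ-zero term
    where
    u∤neighbour : ∀ {z} → adj y z ≡ true → anc p u z ≢ true
    u∤neighbour {z} yz anc-uz with compatible y z yz
    ... | inj₂ anc-zy with () ← trans (sym (anc-trans anc-uz anc-zy)) u∤y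
    ... | inj₁ anc-yz with anc-linear anc-uz anc-yz
    ...   | inj₁ anc-uy with () ← trans (sym anc-uy) u∤y
    ...   | inj₂ anc-yu with () ← trans (sym anc-yu) y∤u
    term : ∀ z → Aₘ adj y z * m u z ≡ 0ℚ
    term z = trans ([]*-cong (adj y z) (λ yz → m-outside (¬-not (u∤neighbour yz)))) (ℚ.*-zeroʳ [ adj y z ])

  -- With M the matrix whose columns are the m u, this says that L M is triangular with respect
  -- to the tree order and has diagonal f.
  Lap⊛m-triangular : Compatible adj p → ∀ u y →
                     (Lap adj ⊛ m u) y ≡ [ y == u ] * f u - [ inDesc⁻ p y u ] * (Aₘ adj ⊛ m u) y
  Lap⊛m-triangular compatible u y with position u y
  ... | inj₁ refl = begin
    (Lap adj ⊛ m u) u   ≡⟨ Lap⊛m-self u ⟩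
    f u                 ≡⟨ solve 2 (λ a x → con 1ℚ :* a :- con 0ℚ :* x := a) refl (f u) X ⟨
    1ℚ * f u - 0ℚ * X   ≡⟨ cong₂ (λ a b → [ a ] * f u - [ b ] * X) (==-refl u) (inDesc⁻-self u) ⟨
    [ u == u ] * f u - [ inDesc⁻ p u u ] * X ∎
    where
    open +-*-Solver
    X = (Aₘ adj ⊛ m u) u
  ... | inj₂ (inj₁ u⊐y) = begin
    (Lap adj ⊛ m u) y   ≡⟨ IsPotential.harmonic (m-potential u) y u⊐y ⟩
    0ℚ                  ≡⟨ solve 2 (λ a x → con 0ℚ :* a :- con 0ℚ :* x := con 0ℚ) refl (f u) X ⟨
    0ℚ * f u - 0ℚ * X   ≡⟨ cong₂ (λ a b → [ a ] * f u - [ b ] * X) (==-false (inDesc⁻-≢ {p = p} u⊐y)) y∤⁻u ⟨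
    [ y == u ] * f u - [ inDesc⁻ p y u ] * X ∎
    where
    open +-*-Solver
    X = (Aₘ adj ⊛ m u) y
    y∤⁻u : inDesc⁻ p y u ≡ false
    y∤⁻u = inDesc⁻-outside {p = p} (⊐⇒non-anc u⊐y)
  ... | inj₂ (inj₂ u∤y) with position y u
  ...   | inj₁ refl with () ← trans (sym (Ancestry.anc-refl p u)) u∤y
  ...   | inj₂ (inj₁ y⊐u) = begin
    (Lap adj ⊛ m u) y   ≡⟨ Lap⊛m-outside u∤y ⟩
    - X                 ≡⟨ solve 2 (λ a x → con 0ℚ :* a :- con 1ℚ :* x := :- x) refl (f u) X ⟨
    0ℚ * f u - 1ℚ * X   ≡⟨ cong₂ (λ a b → [ a ] * f u - [ b ] * X) (==-false y≢u) y⊐u ⟨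
    [ y == u ] * f u - [ inDesc⁻ p y u ] * X ∎
    where
    open +-*-Solver
    X = (Aₘ adj ⊛ m u) y
    y≢u = Ancestry.non-anc⇒≢ p u∤y
  ...   | inj₂ (inj₂ y∤u) = begin
    (Lap adj ⊛ m u) y   ≡⟨ Lap⊛m-outside u∤y ⟩
    - X                 ≡⟨ cong -_ X≡0 ⟩
    0ℚ                  ≡⟨ solve 1 (λ a → con 0ℚ :* a :- con 0ℚ :* con 0ℚ := con 0ℚ) refl (f u) ⟨
    0ℚ * f u - 0ℚ * 0ℚ  ≡⟨ cong (λ x → 0ℚ * f u - 0ℚ * x) X≡0 ⟨
    0ℚ * f u - 0ℚ * X   ≡⟨ cong₂ (λ a b → [ a ] * f u - [ b ] * X) (==-false y≢u) y∤⁻u ⟨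
    [ y == u ] * f u - [ inDesc⁻ p y u ] * X ∎
    where
    open +-*-Solver
    X = (Aₘ adj ⊛ m u) y
    y≢u = Ancestry.non-anc⇒≢ p u∤y
    y∤⁻u = inDesc⁻-outside {p = p} y∤u
    X≡0 = A⊛m-incomparable compatible u∤y y∤u

  Σ-below-Lap⊛m : Compatible adj p → ∀ {v y} → inDesc⁻ p v y ≡ true → (c : Vector ℚ n) →
                  Σℚ (λ u → [ inDesc⁻ p v u ] * (c u * (Lap adj ⊛ m u) y)) ≡
                  c y * f y - Σℚ (λ u → [ inDesc⁻ p y u ] * (c u * (Aₘ adj ⊛ m u) y))
  Σ-below-Lap⊛m compatible {v} {y} v⊐y c = begin
    Σℚ (λ u → [ inDesc⁻ p v u ] * (c u * (Lap adj ⊛ m u) y))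
      ≡⟨ Σℚ-cong term ⟩
    Σℚ (λ u → [ y == u ] * (c u * f u) - [ T u ] * (c u * X u))
      ≡⟨ Σℚ-distrib-- (λ u → [ y == u ] * (c u * f u)) (λ u → [ T u ] * (c u * X u)) ⟩
    Σℚ (λ u → [ y == u ] * (c u * f u)) - Σℚ (λ u → [ T u ] * (c u * X u))
      ≡⟨ cong (_- Σℚ (λ u → [ T u ] * (c u * X u))) (Σℚ-δ y (λ u → c u * f u)) ⟩
    c y * f y - Σℚ (λ u → [ T u ] * (c u * X u)) ∎
    where
    open +-*-Solver
    T = inDesc⁻ p y
    X : Fin n → ℚ
    X u = (Aₘ adj ⊛ m u) y
    distribute : ∀ c a g b x → c * (a * g - b * x) ≡ a * (c * g) - b * (c * x)
    distribute = solve 5 (λ c a g b x → c :* (a :* g :- b :* x) := a :* (c :* g) :- b :* (c :* x)) refl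
    vanish : ∀ {u} → inDesc⁻ p v u ≡ false → [ y == u ] * (c u * f u) - [ T u ] * (c u * X u) ≡ 0ℚ
    vanish {u} v∤⁻u = begin
      [ y == u ] * (c u * f u) - [ T u ] * (c u * X u)
        ≡⟨ cong₂ (λ a b → [ a ] * (c u * f u) - [ b ] * (c u * X u)) (==-false y≢u) (¬-not y∤⁻u) ⟩
      0ℚ * (c u * f u) - 0ℚ * (c u * X u)
        ≡⟨ solve 2 (λ a b → con 0ℚ :* a :- con 0ℚ :* b := con 0ℚ) refl (c u * f u) (c u * X u) ⟩
      0ℚ ∎
      where
      y≢u : y ≢ u
      y≢u refl with () ← trans (sym v⊐y) v∤⁻u
      y∤⁻u : T u ≢ true
      y∤⁻u y⊐u with () ← trans (sym (⊐-trans v⊐y y⊐u)) v∤⁻u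
    term : ∀ u → [ inDesc⁻ p v u ] * (c u * (Lap adj ⊛ m u) y) ≡ [ y == u ] * (c u * f u) - [ T u ] * (c u * X u)
    term u = trans (cong (λ q → [ inDesc⁻ p v u ] * (c u * q)) (Lap⊛m-triangular compatible u y))
                   ([ inDesc⁻ p v u ]*-by-cases (λ _ → distribute (c u) [ y == u ] (f u) [ T u ] (X u)) vanish)

  f-nonzero : Connected adj → ∀ {u} → u ≢ root → f u ≢ 0ℚ
  f-nonzero connected {u} u≢root f≡0 = ℚ.1≢0 (begin
    1ℚ         ≡⟨ m-self u ⟨
    m u u      ≡⟨ maximum-principle adj connected (m u) harmonic-at-maxima u root ⟩
    m u root   ≡⟨ m-outside u∤root ⟩
    0ℚ         ∎)
    where
    u∤root : anc p u root ≡ false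
    u∤root = ¬-not (λ anc-u-root → u≢root (anc-antisym anc-u-root (root-anc u)))
    harmonic-at-maxima : ∀ j → IsMaximum (m u) j → (Lap adj ⊛ m u) j ≡ 0ℚ
    harmonic-at-maxima j max-j with position u j
    ... | inj₁ refl       = trans (Lap⊛m-self u) f≡0
    ... | inj₂ (inj₁ u⊐j) = IsPotential.harmonic (m-potential u) j u⊐j
    ... | inj₂ (inj₂ u∤j) = contradiction (ℚ.<-≤-trans (ℚ.positive⁻¹ 1ℚ) 1≤0) (ℚ.<-irrefl refl)
      where
      1≤0 : 1ℚ ≤ 0ℚ
      1≤0 = subst₂ _≤_ (m-self u) (m-outside u∤j) (max-j u)

  f-nonzero-below : Connected adj → ∀ {v u} → inDesc⁻ p v u ≡ true → f u ≢ 0ℚ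
  f-nonzero-below connected {v} {u} v⊐u = f-nonzero connected u≢root
    where
    u≢root : u ≢ root
    u≢root refl = inDesc⁻-≢ {p = p} v⊐u (anc-antisym (root-anc v) (inDesc⁻-anc {p = p} v⊐u))

  expansion-potential : Compatible adj p → Connected adj → ∀ v →
                        (∀ {y} → y ⊏ v → ∀ x → m y x ≡ expansion y x) → IsPotential v (expansion v)
  expansion-potential compatible connected v IH = record
    { at-self = at-self ; outside = outside ; harmonic = harmonic }
    where
    open +-*-Solver
    S = inDesc⁻ p v
    k : Fin n → ℚ
    k u = coeff v u * inv (f u)
    below-vanishes : ∀ {x} → (∀ {u} → S u ≡ true → anc p u x ≡ false) →
                     Σℚ (λ u → [ S u ] * (k u * m u x)) ≡ 0ℚ
    below-vanishes u∤x =
      Σℚ-zero-on S (λ u v⊐u → trans (cong (k u *_) (m-outside (u∤x v⊐u))) (ℚ.*-zeroʳ (k u)))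
    at-self : expansion v v ≡ 1ℚ
    at-self = begin
      [ v == v ] + Σℚ (λ u → [ S u ] * (k u * m u v))
        ≡⟨ cong₂ _+_ (cong [_] (==-refl v)) (below-vanishes ⊐⇒non-anc) ⟩
      1ℚ + 0ℚ
        ≡⟨ ℚ.+-identityʳ 1ℚ ⟩
      1ℚ ∎
    outside : ∀ x → anc p v x ≡ false → expansion v x ≡ 0ℚ
    outside x v∤x = begin
      [ x == v ] + Σℚ (λ u → [ S u ] * (k u * m u x))
        ≡⟨ cong₂ _+_ (cong [_] (==-false (Ancestry.non-anc⇒≢ p v∤x))) (below-vanishes (¬-not ∘ u∤x)) ⟩
      0ℚ + 0ℚ
        ≡⟨ ℚ.+-identityʳ 0ℚ ⟩
      0ℚ ∎
      where
      u∤x : ∀ {u} → S u ≡ true → anc p u x ≢ true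
      u∤x v⊐u anc-ux with () ← trans (sym (anc-trans (inDesc⁻-anc {p = p} v⊐u) anc-ux)) v∤x
    harmonic : ∀ y → S y ≡ true → (Lap adj ⊛ expansion v) y ≡ 0ℚ
    -- The recurrence for y turns coeff v y = (A m y)(v) into A v y plus exactly the sum that
    -- the proper descendants of y contribute, with the opposite sign, to (L (expansion v))(y).
    harmonic y v⊐y = begin
      (Lap adj ⊛ expansion v) y
        ≡⟨ ⊛-unit+combination (Lap adj) v (λ u → [ S u ]) k m y ⟩
      Lap adj y v + Σℚ (λ u → [ S u ] * (k u * (Lap adj ⊛ m u) y))
        ≡⟨ cong (Lap adj y v +_) (Σ-below-Lap⊛m compatible v⊐y k) ⟩
      Lap adj y v + (k y * f y - Σℚ (λ u → [ T u ] * (k u * (Aₘ adj ⊛ m u) y)))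
        ≡⟨ cong₂ (λ a b → Lap adj y v + (a - b)) k-f (Σℚ-cong (λ u → cong ([ T u ] *_) (coeff-swap v y u))) ⟩
      Lap adj y v + (coeff v y - Σ′)
        ≡⟨ cong (λ c → Lap adj y v + (c - Σ′)) coeff-expanded ⟩
      Lap adj y v + (Aₘ adj v y + Σ′ - Σ′)
        ≡⟨ cong₂ (λ l a → l + (a + Σ′ - Σ′)) (Lap-offdiag (inDesc⁻-≢ {p = p} v⊐y)) (A-sym v y) ⟩
      - Aₘ adj y v + (Aₘ adj y v + Σ′ - Σ′)
        ≡⟨ solve 2 (λ a s → :- a :+ (a :+ s :- s) := con 0ℚ) refl (Aₘ adj y v) Σ′ ⟩
      0ℚ ∎
      where
      T = inDesc⁻ p y
      k′ : Fin n → ℚ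
      k′ u = coeff y u * inv (f u)
      Σ′ = Σℚ (λ u → [ T u ] * (k′ u * (Aₘ adj ⊛ m u) v))
      k-f : k y * f y ≡ coeff v y
      k-f = begin
        (coeff v y * inv (f y)) * f y ≡⟨ ℚ.*-assoc (coeff v y) (inv (f y)) (f y) ⟩
        coeff v y * (inv (f y) * f y) ≡⟨ cong (coeff v y *_) (inv-inverseˡ (f y) (f-nonzero-below connected v⊐y)) ⟩
        coeff v y * 1ℚ                ≡⟨ ℚ.*-identityʳ (coeff v y) ⟩
        coeff v y                     ∎
      coeff-expanded : coeff v y ≡ Aₘ adj v y + Σ′
      coeff-expanded = begin
        coeff v y                    ≡⟨ coeff≡A⊛m v y ⟩
        (Aₘ adj ⊛ m y) v             ≡⟨ Σℚ-cong (λ z → cong (Aₘ adj v z *_) (IH v⊐y z)) ⟩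
        (Aₘ adj ⊛ expansion y) v     ≡⟨ ⊛-unit+combination (Aₘ adj) y (λ u → [ T u ]) k′ m v ⟩
        Aₘ adj v y + Σ′              ∎

  recurrence : Compatible adj p → Connected adj → ∀ v x → m v x ≡ expansion v x
  recurrence compatible connected = All.wfRec ⊏-wellFounded 0ℓ Recurrence inductive-step
    where
    Recurrence : Fin n → Set
    Recurrence v = ∀ x → m v x ≡ expansion v x
    inductive-step : ∀ v → (∀ {y} → y ⊏ v → Recurrence y) → Recurrence v
    inductive-step v IH x = sym (potential-unique (expansion-potential compatible connected v IH) x)

lemma4p2 : (n : ℕ) (adj : Graph n) (p : Parent n) (Linv : Fin n → Fin n → Fin n → ℚ) →
  IsSimple adj → Connected adj → IsRootedTree p → Compatible adj p →
  (∀ u → IsSubInverse (inDesc⁻ p u) (Lap adj) (Linv u)) →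
  ∀ (v : Fin n) →
    (∀ u → inDesc⁻ p v u ≡ true → Index.f adj p Linv u ≢ 0ℚ) ×
    (∀ x → Index.m adj p Linv v x ≡
       Index.e adj p Linv v x +
       Σℚ (λ u → [ inDesc⁻ p v u ] *
         ((Σℚ (λ y → [ adj v y ∧ inDesc p u y ] * Index.m adj p Linv u y)
           * inv (Index.f adj p Linv u))
          * Index.m adj p Linv u x))) ×
    (Index.f adj p Linv v ≡
       deg adj v - Σℚ (λ y → [ adj v y ∧ inDesc p v y ] * Index.m adj p Linv v y))
lemma4p2 n adj p Linv simple connected tree compatible inverses v =
    (λ u → f-nonzero-below connected)
  , recurrence compatible connected v
  , trans (f≡deg-A⊛m v) (cong (λ c → deg adj v - c) (sym (coeff≡A⊛m v v)))
  where
  open IndexVectors adj p Linv using (coeff≡A⊛m)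
  open Potentials adj p Linv simple tree inverses
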